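{- Let $m \geq 3$, let $n \geq 4$ be even, and let $0 < d < n$ with $\gcd(d,n)=1$. Then the Cayley graph $\mathrm{Cay}(\mathbb{Z}_m \times \mathbb{Z}_n, \{\pm 1\}\times\{\pm d\})$ admits a $C_n$-factorization consisting of two $C_n$-factors.
   Context: For a finite additive group $\Gamma$ and a subset $S\subseteq \Gamma\setminus\{0\}$ with $S=-S$, the Cayley graph $\mathrm{Cay}(\Gamma,S)$ has vertex set $\Gamma$ and edge set $\{\{a,b\}: a,b\in\Gamma,\ a-b\in S\}$. Here $\{\pm 1\}\times\{\pm d\}=\{(\epsilon,\delta d): \epsilon,\delta\in\{1,-1\}\}\subseteq \mathbb{Z}_m\times\mathbb{Z}_n$. A $C_k$-factor of a graph is a spanning subgraph each of whose components is a cycle of length $k$; a $C_k$-factorization is a partition of the edge set into $C_k$-factors. -}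

module Defs where

open import Data.Nat using (ℕ; zero; suc; _+_; _∸_; NonZero)
open import Data.Nat.DivMod using (_%_; m%n<n)
open import Data.Fin using (Fin; toℕ; fromℕ<)
open import Data.Product using (Σ; _×_; _,_; ∃)
open import Data.Sum using (_⊎_)
open import Relation.Binary.PropositionalEquality using (_≡_)
open import Relation.Nullary using (¬_)

module _ (m : ℕ) .{{_ : NonZero m}} where
  mod : ℕ → Fin m
  mod a = fromℕ< (m%n<n a m)

  _−ₘ_ : Fin m → Fin m → Fin m
  a −ₘ b = mod (toℕ a + (m ∸ toℕ b))

  negₘ : Fin m → Fin m
  negₘ a = mod (m ∸ toℕ a)

G : ℕ → ℕ → Set
G m n = Fin m × Fin n

subG : (m n : ℕ) .{{_ : NonZero m}} .{{_ : NonZero n}} → G m n → G m n → G m n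
subG m n (a₁ , a₂) (b₁ , b₂) = (_−ₘ_ m a₁ b₁) , (_−ₘ_ n a₂ b₂)

CayAdj : (m n : ℕ) .{{_ : NonZero m}} .{{_ : NonZero n}} →
         (G m n → Set) → G m n → G m n → Set
CayAdj m n S a b = S (subG m n a b)

PM1×PMd : (m n d : ℕ) .{{_ : NonZero m}} .{{_ : NonZero n}} → G m n → Set
PM1×PMd m n d (x , y) =
  (x ≡ mod m 1 ⊎ x ≡ negₘ m (mod m 1)) × (y ≡ mod n d ⊎ y ≡ negₘ n (mod n d))

nextF : (k : ℕ) .{{_ : NonZero k}} → Fin k → Fin k
nextF k i = mod k (suc (toℕ i))

record Cycle {V : Set} (Adj : V → V → Set) (k : ℕ) .{{_ : NonZero k}} : Set where
  field
    vert     : Fin k → V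
    injective : ∀ i j → vert i ≡ vert j → i ≡ j
    adjacent : ∀ i → Adj (vert i) (vert (nextF k i))
open Cycle public

EdgeOfCycle : {V : Set} {Adj : V → V → Set} {k : ℕ} .{{_ : NonZero k}} →
              Cycle Adj k → V → V → Set
EdgeOfCycle {k = k} C u v =
  Σ (Fin k) λ i → (vert C i ≡ u × vert C (nextF k i) ≡ v)
                ⊎ (vert C i ≡ v × vert C (nextF k i) ≡ u)

record CkFactor {V : Set} (Adj : V → V → Set) (k : ℕ) .{{_ : NonZero k}} : Set where
  field
    count    : ℕ
    cycles   : Fin count → Cycle Adj k
    covers   : ∀ v → Σ (Fin count) λ j → Σ (Fin k) λ i → vert (cycles j) i ≡ v
    disjoint : ∀ j j' i i' → vert (cycles j) i ≡ vert (cycles j') i' → j ≡ j'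
open CkFactor public

EdgeOfFactor : {V : Set} {Adj : V → V → Set} {k : ℕ} .{{_ : NonZero k}} →
               CkFactor Adj k → V → V → Set
EdgeOfFactor F u v = Σ (Fin (count F)) λ j → EdgeOfCycle (cycles F j) u v

-- a C_k-factorization consisting of two C_k-factors F₁, F₂:
-- every edge of the graph lies in exactly one of F₁, F₂
-- (edges of the factors are graph edges by construction)
TwoCkFactorization : {V : Set} (Adj : V → V → Set) (k : ℕ) .{{_ : NonZero k}} → Set
TwoCkFactorization Adj k =
  Σ (CkFactor Adj k) λ F₁ → Σ (CkFactor Adj k) λ F₂ →
    (∀ u v → Adj u v → EdgeOfFactor F₁ u v ⊎ EdgeOfFactor F₂ u v)
  × (∀ u v → ¬ (EdgeOfFactor F₁ u v × EdgeOfFactor F₂ u v))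

-- Let e be the inverse of d modulo n and call k = y e the position of the row y, so that
-- the rows y, y + d, y + 2d, … have consecutive positions. For p ∈ {0, 1} the p-th factor
-- consists of the m zigzag cycles
--   (j, 0), (j + (−1)^p, d), (j, 2d), (j + (−1)^p, 3d), …,
-- which close up after n steps because n is even. Equivalently, in factor p a vertex whose
-- row has position of parity q is joined to row y + d in the column shifted by (−1)^(p+q).
-- So an edge {(a, y), (a ± 1, y + d)} lies in the factor whose p matches its column shift,
-- and in only that one: the two factors cannot share an edge since 1 ≢ −1 (mod m) for
-- m ≥ 3, and 2d ≢ 0 (mod n) for n ≥ 3.

module Submission where

open import Defs
open import Data.Nat using (ℕ; _≤_; _<_; NonZero)
open import Data.Nat.GCD using (gcd)
open import Data.Nat.Divisibility using (_∣_)
open import Relation.Binary.PropositionalEquality using (_≡_)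

open import Data.Empty using (⊥; ⊥-elim)
open import Data.Fin using (Fin; toℕ)
open import Data.Fin.Properties using (toℕ-fromℕ<; toℕ-injective; toℕ<n)
open import Data.Nat using (suc; _+_; _*_; _∸_; _%_; _/_; >-nonZero⁻¹; parity)
open import Data.Nat.Properties
  using (+-comm; +-assoc; +-identityʳ; *-assoc; *-identityʳ; *-zeroʳ; <⇒≤; m+[n∸m]≡n; m∸n+n≡m;
         +-commutativeSemigroup; *-commutativeSemigroup)
open import Data.Nat.DivMod
  using (m%n%n≡m%n; %-remove-+ˡ; %-distribˡ-+; %-distribˡ-*; m<n⇒m%n≡m; m%n≤n;
         m≡m%n+[m/n]*n; [m+kn]%n≡m%n)
open import Data.Nat.Divisibility using (divides; ∣-refl)
open import Data.Nat.GCD using (GCD; gcd-GCD; module Bézout)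
open import Data.Nat.Tactic.RingSolver using (solve-∀)
open import Data.Parity using (Parity; 0ℙ; 1ℙ; _⁻¹) renaming (_+_ to _+ℙ_; _*_ to _*ℙ_)
import Data.Parity.Properties as ℙ
open import Data.Product using (Σ; _×_; _,_; proj₁; proj₂)
open import Data.Sum using (_⊎_; inj₁; inj₂)
open import Data.Sum.Function.Propositional using (_⊎-⇔_)
open import Function using (_∘_; _⇔_; mk⇔; Equivalence)
open import Function.Construct.Composition using (_⇔-∘_)
open import Relation.Binary.Bundles using (Setoid)
open import Relation.Binary.PropositionalEquality
  using (refl; sym; trans; cong; cong₂; subst; subst₂; module ≡-Reasoning)
import Relation.Binary.Reasoning.Setoid as SetoidReasoning
open import Relation.Nullary using (¬_)
import Algebra.Properties.CommutativeSemigroup as CommutativeSemigroupProperties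

open Equivalence using (to; from)

module ℕ+ = CommutativeSemigroupProperties +-commutativeSemigroup
module ℕ* = CommutativeSemigroupProperties *-commutativeSemigroup

parity-even : ∀ {n} → 2 ∣ n → parity n ≡ 0ℙ
parity-even {n} (divides q n≡q*2) = begin
  parity n            ≡⟨ cong parity n≡q*2 ⟩
  parity (q * 2)      ≡⟨ ℙ.*-homo-* q 2 ⟩
  parity q *ℙ 0ℙ      ≡⟨ ℙ.*-zeroʳ (parity q) ⟩
  0ℙ                  ∎
  where open ≡-Reasoning

p+[p+q]≡q : ∀ p q → p +ℙ (p +ℙ q) ≡ q
p+[p+q]≡q 0ℙ q = refl
p+[p+q]≡q 1ℙ q = ℙ.⁻¹-involutive q

module Modular (N : ℕ) .{{_ : NonZero N}} where

  infix 4 _≈_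
  _≈_ : ℕ → ℕ → Set
  a ≈ b = a % N ≡ b % N

  ≈-setoid : Setoid _ _
  ≈-setoid = record
    { Carrier = ℕ ; _≈_ = _≈_ ; isEquivalence = record { refl = refl ; sym = sym ; trans = trans } }

  module ≈-Reasoning = SetoidReasoning ≈-setoid

  ≡⇒≈ : ∀ {a b} → a ≡ b → a ≈ b
  ≡⇒≈ = cong (_% N)

  %≈ : ∀ a → a % N ≈ a
  %≈ a = m%n%n≡m%n a N

  N+≈ : ∀ a → N + a ≈ a
  N+≈ a = %-remove-+ˡ a ∣-refl

  N≈0 : N ≈ 0
  N≈0 = trans (cong (_% N) (sym (+-identityʳ N))) (N+≈ 0)

  +-cong : ∀ {a a' b b'} → a ≈ a' → b ≈ b' → a + b ≈ a' + b'
  +-cong {a} {a'} {b} {b'} a≈a' b≈b' = begin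
    (a + b) % N            ≡⟨ %-distribˡ-+ a b N ⟩
    (a % N + b % N) % N    ≡⟨ cong₂ (λ x y → (x + y) % N) a≈a' b≈b' ⟩
    (a' % N + b' % N) % N  ≡⟨ %-distribˡ-+ a' b' N ⟨
    (a' + b') % N          ∎
    where open ≡-Reasoning

  +-congˡ : ∀ a {b b'} → b ≈ b' → a + b ≈ a + b'
  +-congˡ a = +-cong {a} refl

  +-congʳ : ∀ b {a a'} → a ≈ a' → a + b ≈ a' + b
  +-congʳ b a≈a' = +-cong {b = b} a≈a' refl

  *-cong : ∀ {a a' b b'} → a ≈ a' → b ≈ b' → a * b ≈ a' * b'
  *-cong {a} {a'} {b} {b'} a≈a' b≈b' = begin
    (a * b) % N             ≡⟨ %-distribˡ-* a b N ⟩
    (a % N * (b % N)) % N   ≡⟨ cong₂ (λ x y → (x * y) % N) a≈a' b≈b' ⟩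
    (a' % N * (b' % N)) % N ≡⟨ %-distribˡ-* a' b' N ⟨
    (a' * b') % N           ∎
    where open ≡-Reasoning

  *-congˡ : ∀ a {b b'} → b ≈ b' → a * b ≈ a * b'
  *-congˡ a = *-cong {a} refl

  *-congʳ : ∀ b {a a'} → a ≈ a' → a * b ≈ a' * b
  *-congʳ b a≈a' = *-cong {b = b} a≈a' refl

  +-cancelʳ : ∀ a b c → a + c ≈ b + c → a ≈ b
  +-cancelʳ a b c a+c≈b+c = begin
    a                 ≈⟨ absorb a ⟨
    a + (c + c̄)       ≡⟨ +-assoc a c c̄ ⟨
    a + c + c̄         ≈⟨ +-congʳ c̄ a+c≈b+c ⟩
    b + c + c̄         ≡⟨ +-assoc b c c̄ ⟩
    b + (c + c̄)       ≈⟨ absorb b ⟩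
    b                 ∎
    where
    open ≈-Reasoning
    c̄ = N ∸ c % N
    absorb : ∀ x → x + (c + c̄) ≈ x
    absorb x = begin
      x + (c + c̄)       ≈⟨ +-congˡ x (+-congʳ c̄ (%≈ c)) ⟨
      x + (c % N + c̄)   ≡⟨ cong (x +_) (m+[n∸m]≡n (m%n≤n c N)) ⟩
      x + N             ≡⟨ +-comm x N ⟩
      N + x             ≈⟨ N+≈ x ⟩
      x                 ∎

  <-≈⇒≡ : ∀ {a b} → a < N → b < N → a ≈ b → a ≡ b
  <-≈⇒≡ a<N b<N a≈b = trans (sym (m<n⇒m%n≡m a<N)) (trans a≈b (m<n⇒m%n≡m b<N))

  2≉0 : 2 < N → ¬ 2 ≈ 0
  2≉0 2<N 2≈0 with <-≈⇒≡ 2<N (>-nonZero⁻¹ N) 2≈0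
  ... | ()

  gcd≡1⇒invertible : ∀ {d} → gcd d N ≡ 1 → Σ ℕ λ e → e * d ≈ 1
  gcd≡1⇒invertible {d} gcd≡1 with Bézout.identity (subst (GCD d N) gcd≡1 (gcd-GCD d N))
  ... | Bézout.+- x y 1+yN≡xd = x , trans (cong (_% N) (sym 1+yN≡xd)) ([m+kn]%n≡m%n 1 y N)
  ... | Bézout.-+ x y 1+xd≡yN = (N ∸ 1) * x , +-cancelʳ _ 1 (N ∸ 1) (begin
    (N ∸ 1) * x * d + (N ∸ 1)   ≡⟨ factor (N ∸ 1) x d ⟩
    (N ∸ 1) * (1 + x * d)       ≡⟨ cong ((N ∸ 1) *_) 1+xd≡yN ⟩
    (N ∸ 1) * (y * N)           ≈⟨ *-congˡ (N ∸ 1) ([m+kn]%n≡m%n 0 y N) ⟩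
    (N ∸ 1) * 0                 ≡⟨ *-zeroʳ (N ∸ 1) ⟩
    0                           ≈⟨ N≈0 ⟨
    N                           ≡⟨ m+[n∸m]≡n (>-nonZero⁻¹ N) ⟨
    1 + (N ∸ 1)                 ∎)
    where
    open ≈-Reasoning
    factor : ∀ t x d → t * x * d + t ≡ t * (1 + x * d)
    factor = solve-∀

  x*d*e≈x : ∀ {d e} → e * d ≈ 1 → ∀ x → x * d * e ≈ x
  x*d*e≈x {d} {e} e*d≈1 x = begin
    x * d * e    ≡⟨ ℕ*.xy∙z≈x∙zy x d e ⟩
    x * (e * d)  ≈⟨ *-congˡ x e*d≈1 ⟩
    x * 1        ≡⟨ *-identityʳ x ⟩
    x            ∎
    where open ≈-Reasoning

  x*e*d≈x : ∀ {d e} → e * d ≈ 1 → ∀ x → x * e * d ≈ x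
  x*e*d≈x {d} {e} e*d≈1 x = begin
    x * e * d    ≡⟨ *-assoc x e d ⟩
    x * (e * d)  ≈⟨ *-congˡ x e*d≈1 ⟩
    x * 1        ≡⟨ *-identityʳ x ⟩
    x            ∎
    where open ≈-Reasoning

  *-cancelʳ-invertible : ∀ {d e} → e * d ≈ 1 → ∀ a b → a * d ≈ b * d → a ≈ b
  *-cancelʳ-invertible {d} {e} e*d≈1 a b a*d≈b*d = begin
    a          ≈⟨ x*d*e≈x e*d≈1 a ⟨
    a * d * e  ≈⟨ *-congʳ e a*d≈b*d ⟩
    b * d * e  ≈⟨ x*d*e≈x e*d≈1 b ⟩
    b          ∎
    where open ≈-Reasoning

  parity-% : 2 ∣ N → ∀ a → parity (a % N) ≡ parity a
  parity-% 2∣N a = begin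
    parity (a % N)                         ≡⟨ ℙ.+-identityʳ _ ⟨
    parity (a % N) +ℙ 0ℙ                   ≡⟨ cong (parity (a % N) +ℙ_) parity[[a/N]*N]≡0 ⟨
    parity (a % N) +ℙ parity (a / N * N)   ≡⟨ ℙ.+-homo-+ (a % N) (a / N * N) ⟨
    parity (a % N + a / N * N)             ≡⟨ cong parity (m≡m%n+[m/n]*n a N) ⟨
    parity a                               ∎
    where
    open ≡-Reasoning
    parity[[a/N]*N]≡0 : parity (a / N * N) ≡ 0ℙ
    parity[[a/N]*N]≡0 = trans (ℙ.*-homo-* (a / N) N)
      (trans (cong (parity (a / N) *ℙ_) (parity-even 2∣N)) (ℙ.*-zeroʳ (parity (a / N))))

  ≈⇒parity≡ : 2 ∣ N → ∀ {a b} → a ≈ b → parity a ≡ parity b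
  ≈⇒parity≡ 2∣N {a} {b} a≈b = trans (sym (parity-% 2∣N a)) (trans (cong parity a≈b) (parity-% 2∣N b))

  toℕ-mod≈ : ∀ a → toℕ (mod N a) ≈ a
  toℕ-mod≈ a = trans (cong (_% N) (toℕ-fromℕ< _)) (%≈ a)

  toℕ-≈-injective : ∀ {i j : Fin N} → toℕ i ≈ toℕ j → i ≡ j
  toℕ-≈-injective = toℕ-injective ∘ <-≈⇒≡ (toℕ<n _) (toℕ<n _)

  mod-≈-injective : ∀ {a b} → mod N a ≡ mod N b → a ≈ b
  mod-≈-injective {a} {b} eq = trans (sym (toℕ-mod≈ a)) (trans (≡⇒≈ (cong toℕ eq)) (toℕ-mod≈ b))

  mod-≈⇒≡ : ∀ {a} {i : Fin N} → a ≈ toℕ i → mod N a ≡ i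
  mod-≈⇒≡ {a} a≈i = toℕ-≈-injective (trans (toℕ-mod≈ a) a≈i)

  toℕ-−ₘ : ∀ (a b : Fin N) → toℕ (_−ₘ_ N a b) + toℕ b ≈ toℕ a
  toℕ-−ₘ a b = begin
    toℕ (_−ₘ_ N a b) + toℕ b       ≈⟨ +-congʳ (toℕ b) (toℕ-mod≈ _) ⟩
    toℕ a + (N ∸ toℕ b) + toℕ b    ≡⟨ +-assoc (toℕ a) _ _ ⟩
    toℕ a + (N ∸ toℕ b + toℕ b)    ≡⟨ cong (toℕ a +_) (m∸n+n≡m (<⇒≤ (toℕ<n b))) ⟩
    toℕ a + N                      ≡⟨ +-comm (toℕ a) N ⟩
    N + toℕ a                      ≈⟨ N+≈ (toℕ a) ⟩
    toℕ a                          ∎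
    where open ≈-Reasoning

  toℕ-negₘ : ∀ (a : Fin N) → toℕ (negₘ N a) + toℕ a ≈ 0
  toℕ-negₘ a = begin
    toℕ (negₘ N a) + toℕ a   ≈⟨ +-congʳ (toℕ a) (toℕ-mod≈ _) ⟩
    N ∸ toℕ a + toℕ a        ≡⟨ m∸n+n≡m (<⇒≤ (toℕ<n a)) ⟩
    N                        ≈⟨ N≈0 ⟩
    0                        ∎
    where open ≈-Reasoning

  −ₘ≡⇔ : ∀ (a b x : Fin N) → (_−ₘ_ N a b ≡ x) ⇔ (toℕ x + toℕ b ≈ toℕ a)
  −ₘ≡⇔ a b x = mk⇔
    (λ { refl → toℕ-−ₘ a b })
    (λ x+b≈a → toℕ-≈-injective (+-cancelʳ _ _ (toℕ b) (trans (toℕ-−ₘ a b) (sym x+b≈a))))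

  negₘ-+≈⇔ : ∀ (x a b : Fin N) → (toℕ (negₘ N x) + toℕ b ≈ toℕ a) ⇔ (toℕ x + toℕ a ≈ toℕ b)
  negₘ-+≈⇔ x a b = mk⇔
    (λ x̄+b≈a → begin
      x' + toℕ a          ≈⟨ +-congˡ x' x̄+b≈a ⟨
      x' + (x̄ + toℕ b)    ≡⟨ ℕ+.x∙yz≈yx∙z x' x̄ (toℕ b) ⟩
      x̄ + x' + toℕ b      ≈⟨ +-congʳ (toℕ b) (toℕ-negₘ x) ⟩
      toℕ b               ∎)
    (λ x+a≈b → +-cancelʳ _ _ x' (begin
      x̄ + toℕ b + x'      ≡⟨ ℕ+.xy∙z≈xz∙y x̄ (toℕ b) x' ⟩
      x̄ + x' + toℕ b      ≈⟨ +-congʳ (toℕ b) (toℕ-negₘ x) ⟩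
      toℕ b               ≈⟨ x+a≈b ⟨
      x' + toℕ a          ≡⟨ +-comm x' (toℕ a) ⟩
      toℕ a + x'          ∎))
    where
    open ≈-Reasoning
    x' = toℕ x
    x̄ = toℕ (negₘ N x)

  −ₘ≡±⇔ : ∀ c (a b : Fin N) →
    (_−ₘ_ N a b ≡ mod N c ⊎ _−ₘ_ N a b ≡ negₘ N (mod N c)) ⇔ (c + toℕ b ≈ toℕ a ⊎ c + toℕ a ≈ toℕ b)
  −ₘ≡±⇔ c a b =
    (toℕ-mod-+⇔ (toℕ b) (toℕ a) ⇔-∘ −ₘ≡⇔ a b (mod N c))
    ⊎-⇔ (toℕ-mod-+⇔ (toℕ a) (toℕ b) ⇔-∘ (negₘ-+≈⇔ (mod N c) a b ⇔-∘ −ₘ≡⇔ a b (negₘ N (mod N c))))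
    where
    toℕ-mod-+⇔ : ∀ x y → (toℕ (mod N c) + x ≈ y) ⇔ (c + x ≈ y)
    toℕ-mod-+⇔ x y = mk⇔ (trans (+-congʳ x (sym (toℕ-mod≈ c)))) (trans (+-congʳ x (toℕ-mod≈ c)))

module Zigzag (m n d : ℕ) .{{_ : NonZero m}} .{{_ : NonZero n}}
              (2<m : 2 < m) (2<n : 2 < n) (2∣n : 2 ∣ n)
              (e : ℕ) (e*d≈1 : Modular._≈_ n (e * d) 1) where

  module ℤₘ = Modular m
  module ℤₙ = Modular n
  open ℤₘ using () renaming (_≈_ to _≈ₘ_)
  open ℤₙ using () renaming (_≈_ to _≈ₙ_)

  Adj : G m n → G m n → Set
  Adj = CayAdj m n (PM1×PMd m n d)

  -- dir s represents (−1)^s in ℤ_m.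
  dir : Parity → ℕ
  dir 0ℙ = 1
  dir 1ℙ = m ∸ 1

  ColStep : Parity → Fin m → Fin m → Set
  ColStep s a b = dir s + toℕ a ≈ₘ toℕ b

  dir+dir⁻¹≈0 : ∀ s → dir s + dir (s ⁻¹) ≈ₘ 0
  dir+dir⁻¹≈0 0ℙ = trans (cong (_% m) (m+[n∸m]≡n (>-nonZero⁻¹ m))) ℤₘ.N≈0
  dir+dir⁻¹≈0 1ℙ = trans (cong (_% m) (m∸n+n≡m (>-nonZero⁻¹ m))) ℤₘ.N≈0

  dir-injective : ∀ {s s'} → dir s ≈ₘ dir s' → s ≡ s'
  dir-injective {0ℙ} {0ℙ} _ = refl
  dir-injective {1ℙ} {1ℙ} _ = refl
  dir-injective {0ℙ} {1ℙ} 1≈m-1 = ⊥-elim (ℤₘ.2≉0 2<m (trans (ℤₘ.+-congˡ 1 1≈m-1) (dir+dir⁻¹≈0 0ℙ)))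
  dir-injective {1ℙ} {0ℙ} m-1≈1 = ⊥-elim (ℤₘ.2≉0 2<m (trans (ℤₘ.+-congˡ 1 (sym m-1≈1)) (dir+dir⁻¹≈0 0ℙ)))

  ColStep-flip : ∀ s {a b} → ColStep s a b → ColStep (s ⁻¹) b a
  ColStep-flip s {a} {b} step = begin
    dir (s ⁻¹) + toℕ b               ≈⟨ ℤₘ.+-congˡ (dir (s ⁻¹)) step ⟨
    dir (s ⁻¹) + (dir s + toℕ a)     ≡⟨ ℕ+.x∙yz≈yx∙z (dir (s ⁻¹)) (dir s) (toℕ a) ⟩
    dir s + dir (s ⁻¹) + toℕ a       ≈⟨ ℤₘ.+-congʳ (toℕ a) (dir+dir⁻¹≈0 s) ⟩
    toℕ a                            ∎
    where open ℤₘ.≈-Reasoning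

  ±1⇔ColStep : ∀ a b → (1 + toℕ b ≈ₘ toℕ a ⊎ 1 + toℕ a ≈ₘ toℕ b) ⇔ Σ Parity λ s → ColStep s a b
  ±1⇔ColStep a b = mk⇔
    (λ { (inj₁ step) → 1ℙ , ColStep-flip 0ℙ step ; (inj₂ step) → 0ℙ , step })
    (λ { (0ℙ , step) → inj₂ step ; (1ℙ , step) → inj₁ (ColStep-flip 1ℙ step) })

  position : Fin n → ℕ
  position y = toℕ y * e

  Succ : Parity → G m n → G m n → Set
  Succ p (a , y) (a' , y') = ColStep (parity (position y) +ℙ p) a a' × d + toℕ y ≈ₙ toℕ y'

  Succ⇒Adj : ∀ {p} u v → Succ p u v → Adj u v
  Succ⇒Adj {p} (a , y) (a' , y') (step , d+y≈y') =
    from (ℤₘ.−ₘ≡±⇔ 1 a a') (from (±1⇔ColStep a a') (parity (position y) +ℙ p , step)) ,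
    from (ℤₙ.−ₘ≡±⇔ d y y') (inj₂ d+y≈y')

  Adj⇒Succ : ∀ u v → Adj u v → Σ Parity λ p → Succ p u v ⊎ Succ p v u
  Adj⇒Succ (a , y) (a' , y') (columns , rows)
    with to (±1⇔ColStep a a') (to (ℤₘ.−ₘ≡±⇔ 1 a a') columns) | to (ℤₙ.−ₘ≡±⇔ d y y') rows
  ... | s , step | inj₁ d+y'≈y =
    q' +ℙ s ⁻¹ , inj₂ (subst (λ t → ColStep t a' a) (sym (p+[p+q]≡q q' (s ⁻¹))) (ColStep-flip s step) , d+y'≈y)
    where q' = parity (position y')
  ... | s , step | inj₂ d+y≈y' =
    q +ℙ s , inj₁ (subst (λ t → ColStep t a a') (sym (p+[p+q]≡q q s)) step , d+y≈y')
    where q = parity (position y)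

  Succ-functional : ∀ {p u v v'} → Succ p u v → Succ p u v' → v ≡ v'
  Succ-functional (step , row) (step' , row') =
    cong₂ _,_ (ℤₘ.toℕ-≈-injective (trans (sym step) step')) (ℤₙ.toℕ-≈-injective (trans (sym row) row'))

  Succ-parity-unique : ∀ {p p' u v} → Succ p u v → Succ p' u v → p ≡ p'
  Succ-parity-unique {p} {p'} {a , y} (step , _) (step' , _) =
    ℙ.+-cancelˡ-≡ (parity (position y)) p p'
      (dir-injective (ℤₘ.+-cancelʳ _ _ (toℕ a) (trans step (sym step'))))

  Succ-no-2-cycle : ∀ {p p' u v} → Succ p u v → Succ p' v u → ⊥
  Succ-no-2-cycle {u = _ , y} {_ , y'} (_ , d+y≈y') (_ , d+y'≈y) = ℤₙ.2≉0 2<n (begin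
    2                ≡⟨ *-identityʳ 2 ⟨
    2 * 1            ≈⟨ ℤₙ.*-congˡ 2 e*d≈1 ⟨
    2 * (e * d)      ≡⟨ regroup e d ⟩
    e * (d + d)      ≈⟨ ℤₙ.*-congˡ e 2d≈0 ⟩
    e * 0            ≡⟨ *-zeroʳ e ⟩
    0                ∎)
    where
    open ℤₙ.≈-Reasoning
    regroup : ∀ e d → 2 * (e * d) ≡ e * (d + d)
    regroup = solve-∀
    2d≈0 : d + d ≈ₙ 0
    2d≈0 = ℤₙ.+-cancelʳ _ 0 (toℕ y) (begin
      d + d + toℕ y    ≡⟨ +-assoc d d (toℕ y) ⟩
      d + (d + toℕ y)  ≈⟨ ℤₙ.+-congˡ d d+y≈y' ⟩
      d + toℕ y'       ≈⟨ d+y'≈y ⟩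
      toℕ y            ∎)

  offset : Parity → Parity → ℕ
  offset p 0ℙ = 0
  offset p 1ℙ = dir p

  offset-step : ∀ p q → dir (q +ℙ p) + offset p q ≈ₘ offset p (q ⁻¹)
  offset-step p  0ℙ = cong (_% m) (+-identityʳ (dir p))
  offset-step 0ℙ 1ℙ = dir+dir⁻¹≈0 1ℙ
  offset-step 1ℙ 1ℙ = dir+dir⁻¹≈0 0ℙ

  zigzag : Parity → Fin m → Fin n → G m n
  zigzag p j k = mod m (toℕ j + offset p (parity (toℕ k))) , mod n (toℕ k * d)

  position-zigzag : ∀ (k : Fin n) → position (mod n (toℕ k * d)) ≈ₙ toℕ k
  position-zigzag k = trans (ℤₙ.*-congʳ e (ℤₙ.toℕ-mod≈ (toℕ k * d))) (ℤₙ.x*d*e≈x e*d≈1 (toℕ k))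

  parity-nextF : ∀ k → parity (toℕ (nextF n k)) ≡ parity (toℕ k) ⁻¹
  parity-nextF k = trans (ℤₙ.≈⇒parity≡ 2∣n (ℤₙ.toℕ-mod≈ (suc (toℕ k)))) (ℙ.+-homo-+ 1 (toℕ k))

  zigzag-Succ : ∀ p j k → Succ p (zigzag p j k) (zigzag p j (nextF n k))
  zigzag-Succ p j k = column , row
    where
    q = parity (toℕ k)
    column : ColStep (parity (position (mod n (toℕ k * d))) +ℙ p)
                     (mod m (toℕ j + offset p q)) (mod m (toℕ j + offset p (parity (toℕ (nextF n k)))))
    column = begin
      dir (parity (position (mod n (toℕ k * d))) +ℙ p) + toℕ (mod m (toℕ j + offset p q))
        ≡⟨ cong (λ t → dir (t +ℙ p) + toℕ (mod m (toℕ j + offset p q))) (ℤₙ.≈⇒parity≡ 2∣n (position-zigzag k)) ⟩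
      dir (q +ℙ p) + toℕ (mod m (toℕ j + offset p q))
        ≈⟨ ℤₘ.+-congˡ (dir (q +ℙ p)) (ℤₘ.toℕ-mod≈ _) ⟩
      dir (q +ℙ p) + (toℕ j + offset p q)
        ≡⟨ ℕ+.x∙yz≈y∙xz (dir (q +ℙ p)) (toℕ j) (offset p q) ⟩
      toℕ j + (dir (q +ℙ p) + offset p q)
        ≈⟨ ℤₘ.+-congˡ (toℕ j) (offset-step p q) ⟩
      toℕ j + offset p (q ⁻¹)
        ≡⟨ cong (λ t → toℕ j + offset p t) (parity-nextF k) ⟨
      toℕ j + offset p (parity (toℕ (nextF n k)))
        ≈⟨ ℤₘ.toℕ-mod≈ _ ⟨
      toℕ (mod m (toℕ j + offset p (parity (toℕ (nextF n k)))))  ∎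
      where open ℤₘ.≈-Reasoning
    row : d + toℕ (mod n (toℕ k * d)) ≈ₙ toℕ (mod n (toℕ (nextF n k) * d))
    row = begin
      d + toℕ (mod n (toℕ k * d))          ≈⟨ ℤₙ.+-congˡ d (ℤₙ.toℕ-mod≈ _) ⟩
      d + toℕ k * d                        ≡⟨⟩
      suc (toℕ k) * d                      ≈⟨ ℤₙ.*-congʳ d (ℤₙ.toℕ-mod≈ _) ⟨
      toℕ (nextF n k) * d                  ≈⟨ ℤₙ.toℕ-mod≈ _ ⟨
      toℕ (mod n (toℕ (nextF n k) * d))    ∎
      where open ℤₙ.≈-Reasoning

  row-injective : ∀ k k' → mod n (toℕ k * d) ≡ mod n (toℕ k' * d) → k ≡ k'
  row-injective k k' eq = ℤₙ.toℕ-≈-injective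
    (ℤₙ.*-cancelʳ-invertible {d} {e} e*d≈1 (toℕ k) (toℕ k') (ℤₙ.mod-≈-injective eq))

  zigzag-injective : ∀ p {j j'} k k' → zigzag p j k ≡ zigzag p j' k' → j ≡ j' × k ≡ k'
  zigzag-injective p k k' eq with refl ← row-injective k k' (cong proj₂ eq) =
    ℤₘ.toℕ-≈-injective (ℤₘ.+-cancelʳ _ _ (offset p (parity (toℕ k))) (ℤₘ.mod-≈-injective (cong proj₁ eq))) , refl

  zigzag-surjective : ∀ p v → Σ (Fin m) λ j → Σ (Fin n) λ k → zigzag p j k ≡ v
  zigzag-surjective p (a , y) = _−ₘ_ m a (mod m o) , k , cong₂ _,_ column row
    where
    k = mod n (position y)
    o = offset p (parity (toℕ k))
    column : mod m (toℕ (_−ₘ_ m a (mod m o)) + o) ≡ a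
    column = ℤₘ.mod-≈⇒≡
      (trans (ℤₘ.+-congˡ (toℕ (_−ₘ_ m a (mod m o))) (sym (ℤₘ.toℕ-mod≈ o))) (ℤₘ.toℕ-−ₘ a (mod m o)))
    row : mod n (toℕ k * d) ≡ y
    row = ℤₙ.mod-≈⇒≡ (trans (ℤₙ.*-congʳ d (ℤₙ.toℕ-mod≈ (position y))) (ℤₙ.x*e*d≈x e*d≈1 (toℕ y)))

  zigzagCycle : Parity → Fin m → Cycle Adj n
  zigzagCycle p j = record
    { vert      = zigzag p j
    ; injective = λ k k' eq → proj₂ (zigzag-injective p k k' eq)
    ; adjacent  = λ k → Succ⇒Adj _ _ (zigzag-Succ p j k)
    }

  zigzagFactor : Parity → CkFactor Adj n
  zigzagFactor p = record
    { count    = m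
    ; cycles   = zigzagCycle p
    ; covers   = zigzag-surjective p
    ; disjoint = λ _ _ k k' eq → proj₁ (zigzag-injective p k k' eq)
    }

  Succ⇒consecutive : ∀ p {u v} → Succ p u v →
    Σ (Fin m) λ j → Σ (Fin n) λ k → zigzag p j k ≡ u × zigzag p j (nextF n k) ≡ v
  Succ⇒consecutive p {u} step with zigzag-surjective p u
  ... | j , k , refl = j , k , refl , Succ-functional (zigzag-Succ p j k) step

  edge-zigzagFactor⇔Succ : ∀ p u v → EdgeOfFactor (zigzagFactor p) u v ⇔ (Succ p u v ⊎ Succ p v u)
  edge-zigzagFactor⇔Succ p u v = mk⇔
    (λ { (j , k , inj₁ (≡u , ≡v)) → inj₁ (subst₂ (Succ p) ≡u ≡v (zigzag-Succ p j k))
       ; (j , k , inj₂ (≡v , ≡u)) → inj₂ (subst₂ (Succ p) ≡v ≡u (zigzag-Succ p j k)) })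
    (λ { (inj₁ step) → let j , k , ≡u , ≡v = Succ⇒consecutive p step in j , k , inj₁ (≡u , ≡v)
       ; (inj₂ step) → let j , k , ≡v , ≡u = Succ⇒consecutive p step in j , k , inj₂ (≡v , ≡u) })

  zigzagFactors-cover : ∀ u v → Adj u v →
    EdgeOfFactor (zigzagFactor 0ℙ) u v ⊎ EdgeOfFactor (zigzagFactor 1ℙ) u v
  zigzagFactors-cover u v adj with Adj⇒Succ u v adj
  ... | 0ℙ , step = inj₁ (from (edge-zigzagFactor⇔Succ 0ℙ u v) step)
  ... | 1ℙ , step = inj₂ (from (edge-zigzagFactor⇔Succ 1ℙ u v) step)

  zigzagFactors-disjoint : ∀ u v →
    ¬ (EdgeOfFactor (zigzagFactor 0ℙ) u v × EdgeOfFactor (zigzagFactor 1ℙ) u v)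
  zigzagFactors-disjoint u v (edge₀ , edge₁)
    with to (edge-zigzagFactor⇔Succ 0ℙ u v) edge₀ | to (edge-zigzagFactor⇔Succ 1ℙ u v) edge₁
  ... | inj₁ step₀ | inj₁ step₁ = ℙ.p≢p⁻¹ 0ℙ (Succ-parity-unique step₀ step₁)
  ... | inj₁ step₀ | inj₂ step₁ = Succ-no-2-cycle step₀ step₁
  ... | inj₂ step₀ | inj₁ step₁ = Succ-no-2-cycle step₀ step₁
  ... | inj₂ step₀ | inj₂ step₁ = ℙ.p≢p⁻¹ 0ℙ (Succ-parity-unique step₀ step₁)

  zigzagFactorization : TwoCkFactorization Adj n
  zigzagFactorization = zigzagFactor 0ℙ , zigzagFactor 1ℙ , zigzagFactors-cover , zigzagFactors-disjoint

lemma2p5 : (m n d : ℕ) .{{_ : NonZero m}} .{{_ : NonZero n}} →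
           3 ≤ m → 4 ≤ n → 2 ∣ n → 0 < d → d < n → gcd d n ≡ 1 →
           TwoCkFactorization (CayAdj m n (PM1×PMd m n d)) n
lemma2p5 m n d 3≤m 4≤n 2∣n _ _ gcd[d,n]≡1 =
  let e , e*d≈1 = Modular.gcd≡1⇒invertible n {d} gcd[d,n]≡1 in
  Zigzag.zigzagFactorization m n d 3≤m (<⇒≤ 4≤n) 2∣n e e*d≈1
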